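{- Let $w=12312123\cdots$ be the fixed point (starting with $1$) of the morphism $1\mapsto12$, $2\mapsto3$, $3\mapsto12$ over $\{1,2,3\}$, with letters indexed from $1$. Define $A_0=B_0=C_0=0$, $A_1=1$, $B_1=2$, $C_1=3$ and for $m>1$: $A_m=\mathrm{mex}\{A_i,B_i,C_i:0\le i<m\}$, $B_m=A_m+1$, and $C_m=C_{m-1}+3$ if $A_m-A_{m-1}=2$, $C_m=C_{m-1}+5$ otherwise. Then for every $m\ge1$, $A_m$, $B_m$, $C_m$ are respectively the indices of the $m$-th occurrence of $1$, of $2$, and of $3$ in $w$. (That is, the set of $\mathcal{P}$-positions of the Raleigh game is coded by $w$.)
   Context: $\mathrm{mex}(S)$ is the smallest non-negative integer not in $S$. The triples $(A_m,B_m,C_m)$ (with their permutations) are the $\mathcal{P}$-positions of the Raleigh game. -}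

module Defs where

open import Data.Nat using (ℕ; zero; suc; _+_; pred)
import Data.Nat as N
open import Data.Bool using (Bool; true; false; if_then_else_)
open import Data.List using (List; []; _∷_; _++_; concatMap)
open import Data.Product using (_×_; _,_; proj₁; proj₂)
open import Relation.Nullary.Decidable using (does)
open import Relation.Binary.PropositionalEquality using (_≡_)

data Letter : Set where
  one two three : Letter

_==L_ : Letter → Letter → Bool
one   ==L one   = true
two   ==L two   = true
three ==L three = true
_     ==L _     = false

φ : Letter → List Letter
φ one   = one ∷ two ∷ []
φ two   = three ∷ []
φ three = one ∷ two ∷ []

φ* : List Letter → List Letter
φ* = concatMap φ

iter : ℕ → List Letter
iter zero    = one ∷ []
iter (suc n) = φ* (iter n)

nth : List Letter → ℕ → Letter
nth []       _       = one
nth (x ∷ xs) zero    = x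
nth (x ∷ xs) (suc i) = nth xs i

-- The fixed point w = lim φ^n(1), letters indexed from 1:
-- w i is the i-th letter (1-indexed) of φ^i(1), which has length > i,
-- and φ^n(1) is a prefix of φ^(n+1)(1) since φ(1) starts with 1.
w : ℕ → Letter
w i = nth (iter i) (pred i)

occ : Letter → ℕ → ℕ
occ x zero    = 0
occ x (suc n) = (if w (suc n) ==L x then 1 else 0) + occ x n

elem : ℕ → List ℕ → Bool
elem n []       = false
elem n (x ∷ xs) = if does (n N.≟ x) then true else elem n xs

-- mex of a finite set given as a list: least k with k ∉ l
-- (searching from k with fuel; fuel = length l + 1 suffices)
mexFrom : ℕ → ℕ → List ℕ → ℕ
mexFrom zero     k l = k
mexFrom (suc f)  k l = if elem k l then mexFrom f (suc k) l else k

mex : List ℕ → ℕ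
mex l = mexFrom (suc (Data.List.length l)) 0 l

-- state m = ((A_m , B_m , C_m) , list of all A_i, B_i, C_i for 0 ≤ i ≤ m)
Triple : Set
Triple = ℕ × ℕ × ℕ

state : ℕ → Triple × List ℕ
state zero          = (0 , 0 , 0) , (0 ∷ 0 ∷ 0 ∷ [])
state (suc zero)    = (1 , 2 , 3) , (1 ∷ 2 ∷ 3 ∷ 0 ∷ 0 ∷ 0 ∷ [])
state (suc (suc k)) with state (suc k)
... | (a' , b' , c') , hist =
  let a = mex hist
      c = if does (a N.≟ a' + 2) then c' + 3 else c' + 5
  in (a , suc a , c) , (a ∷ suc a ∷ c ∷ hist)

A B C : ℕ → ℕ
A m = proj₁ (proj₁ (state m))
B m = proj₁ (proj₂ (proj₁ (state m)))
C m = proj₂ (proj₂ (proj₁ (state m)))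

IsOccurrence : Letter → ℕ → ℕ → Set
IsOccurrence x m n = (w n ≡ x) × (occ x n ≡ m)

-- If the m-th 2 of w is at position p, then w = xs ++ 2 ∷ … with |xs| = p − 1, and applying
-- the morphism shows that the m-th 3 of w sits at 2p − m.  Moreover the only two-letter factors
-- of w are 12, 21, 23 and 31, so consecutive 1's of w are 2 or 3 apart, with a 3 in between in the
-- second case.  By induction on m: if A_m and A_m + 1 are the m-th 1 and 2 of w and C_m + m = 2 B_m,
-- then every position below the next 1 of w is either at most B_m or a 3 occurring at most m times,
-- hence already recorded as some C_i; the next 1 itself is not recorded.  So it is the mex, it is
-- followed by a 2, and the rule for C (a gap of 2 or 3 adds 3 or 5) preserves C + m = 2B.
module Submission where

open import Data.Bool using (true; false; if_then_else_; T)
open import Data.Empty using (⊥-elim)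
open import Data.List using (List; []; _∷_; _++_; length; take)
import Data.List.Properties as List
open import Data.List.Membership.Propositional using (_∈_; _∉_)
open import Data.List.Relation.Unary.All as All using (All; []; _∷_)
open import Data.List.Relation.Unary.Any using (here; there)
open import Data.List.Relation.Unary.Linked using (Linked; []; [-]; _∷_)
open import Data.Nat
open import Data.Nat.Properties
open import Data.Nat.Tactic.RingSolver using (solve-∀)
open import Data.Product using (∃-syntax; _×_; _,_; proj₁; proj₂)
open import Data.Sum using (_⊎_; inj₁; inj₂)
open import Data.Unit using (tt)
open import Relation.Binary.Definitions using (tri<; tri≈; tri>)
open import Relation.Binary.PropositionalEquality
open import Relation.Nullary using (contradiction)
open import Relation.Nullary.Decidable using (does; dec-true; dec-false)

open import Defs

iter-suc-prefix : ∀ n → ∃[ s ] iter (suc n) ≡ iter n ++ s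
iter-suc-prefix zero = two ∷ [] , refl
iter-suc-prefix (suc n) with iter-suc-prefix n
... | s , eq = φ* s , trans (cong φ* eq) (List.concatMap-++ φ (iter n) s)

iter-prefix : ∀ n d → ∃[ s ] iter (d + n) ≡ iter n ++ s
iter-prefix n zero = [] , sym (List.++-identityʳ (iter n))
iter-prefix n (suc d) with iter-prefix n d | iter-suc-prefix (d + n)
... | s , eq | s′ , eq′ = s ++ s′ , (begin
  iter (suc d + n)      ≡⟨ eq′ ⟩
  iter (d + n) ++ s′    ≡⟨ cong (_++ s′) eq ⟩
  (iter n ++ s) ++ s′   ≡⟨ List.++-assoc (iter n) s s′ ⟩
  iter n ++ s ++ s′     ∎)
  where open ≡-Reasoning

iter-head : ∀ n → ∃[ l ] iter n ≡ one ∷ l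
iter-head zero = [] , refl
iter-head (suc n) with iter-head n
... | l , eq = two ∷ φ* l , cong φ* eq

length-≤-φ* : ∀ l → length l ≤ length (φ* l)
length-≤-φ* []          = z≤n
length-≤-φ* (one ∷ l)   = m≤n⇒m≤1+n (s≤s (length-≤-φ* l))
length-≤-φ* (two ∷ l)   = s≤s (length-≤-φ* l)
length-≤-φ* (three ∷ l) = m≤n⇒m≤1+n (s≤s (length-≤-φ* l))

length-iter : ∀ n → n < length (iter n)
length-iter zero = s≤s z≤n
length-iter (suc n) with iter-head n | length-iter n
... | l , eq | n<len rewrite eq = s≤s (≤-trans n<len (s≤s (length-≤-φ* l)))

nth-++ˡ : ∀ xs ys {i} → i < length xs → nth (xs ++ ys) i ≡ nth xs i
nth-++ˡ (x ∷ xs) ys {zero}  _         = refl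
nth-++ˡ (x ∷ xs) ys {suc i} (s≤s i<n) = nth-++ˡ xs ys i<n

nth-iter-stable : ∀ {N M i} → N ≤ M → i < length (iter N) → nth (iter M) i ≡ nth (iter N) i
nth-iter-stable {N} {M} {i} N≤M i<len with iter-prefix N (M ∸ N)
... | s , eq rewrite m∸n+n≡m N≤M = trans (cong (λ l → nth l i) eq) (nth-++ˡ (iter N) s i<len)

w-nth-iter : ∀ N {i} → i < length (iter N) → w (suc i) ≡ nth (iter N) i
w-nth-iter N {i} i<len with ≤-total N (suc i)
... | inj₁ N≤1+i = nth-iter-stable N≤1+i i<len
... | inj₂ 1+i≤N = sym (nth-iter-stable 1+i≤N (≤-trans (n≤1+n _) (length-iter (suc i))))

data _↝_ : Letter → Letter → Set where
  1↝2 : one ↝ two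
  2↝1 : two ↝ one
  2↝3 : two ↝ three
  3↝1 : three ↝ one

linked-φ* : ∀ {l} → Linked _↝_ l → Linked _↝_ (φ* l)
linked-φ* {[]}         []        = []
linked-φ* {one ∷ []}   [-]       = 1↝2 ∷ [-]
linked-φ* {two ∷ []}   [-]       = [-]
linked-φ* {three ∷ []} [-]       = 1↝2 ∷ [-]
linked-φ*              (1↝2 ∷ r) = 1↝2 ∷ 2↝3 ∷ linked-φ* r
linked-φ*              (2↝1 ∷ r) = 3↝1 ∷ linked-φ* r
linked-φ*              (2↝3 ∷ r) = 3↝1 ∷ linked-φ* r
linked-φ*              (3↝1 ∷ r) = 1↝2 ∷ 2↝1 ∷ linked-φ* r

linked-iter : ∀ n → Linked _↝_ (iter n)
linked-iter zero    = [-]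
linked-iter (suc n) = linked-φ* (linked-iter n)

linked-nth : ∀ {l i} → Linked _↝_ l → suc i < length l → nth l i ↝ nth l (suc i)
linked-nth {i = zero}  [-]      (s≤s ())
linked-nth {i = zero}  (r ∷ _)  _           = r
linked-nth {i = suc i} (_ ∷ rs) (s≤s 2+i<n) = linked-nth rs 2+i<n

w-linked : ∀ i → w (suc i) ↝ w (suc (suc i))
w-linked i = subst₂ _↝_ (sym (w-nth-iter N (<-trans (n<1+n i) 1+i<len))) (sym (w-nth-iter N 1+i<len))
  (linked-nth (linked-iter N) 1+i<len)
  where
    N = suc (suc i)
    1+i<len : suc i < length (iter N)
    1+i<len = <-trans (n<1+n (suc i)) (length-iter N)

↝-from-one : ∀ {y} → one ↝ y → y ≡ two
↝-from-one 1↝2 = refl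

↝-from-two : ∀ {y} → two ↝ y → y ≡ one ⊎ y ≡ three
↝-from-two 2↝1 = inj₁ refl
↝-from-two 2↝3 = inj₂ refl

↝-from-three : ∀ {y} → three ↝ y → y ≡ one
↝-from-three 3↝1 = refl

-- Position 0 is junk: w 0 = one, followed by w 1 = one.
one-then-two : ∀ p → 0 < p → w p ≡ one → w (suc p) ≡ two
one-then-two (suc i) _ eq = ↝-from-one (subst (_↝ w (suc (suc i))) eq (w-linked i))

two-then-one-or-three : ∀ p → w p ≡ two → w (suc p) ≡ one ⊎ w (suc p) ≡ three
two-then-one-or-three zero    ()
two-then-one-or-three (suc i) eq = ↝-from-two (subst (_↝ w (suc (suc i))) eq (w-linked i))

three-then-one : ∀ p → w p ≡ three → w (suc p) ≡ one
three-then-one zero    ()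
three-then-one (suc i) eq = ↝-from-three (subst (_↝ w (suc (suc i))) eq (w-linked i))

δ : Letter → Letter → ℕ
δ y x = if y ==L x then 1 else 0

count : Letter → List Letter → ℕ
count x []       = 0
count x (y ∷ ys) = δ y x + count x ys

count-++ : ∀ x xs ys → count x (xs ++ ys) ≡ count x xs + count x ys
count-++ x []       ys = refl
count-++ x (y ∷ xs) ys = trans (cong (δ y x +_) (count-++ x xs ys)) (sym (+-assoc (δ y x) (count x xs) (count x ys)))

take-suc-nth : ∀ l {n} → n < length l → take (suc n) l ≡ take n l ++ nth l n ∷ []
take-suc-nth (x ∷ l) {zero}  _         = refl
take-suc-nth (x ∷ l) {suc n} (s≤s n<len) = cong (x ∷_) (take-suc-nth l n<len)

occ-take : ∀ x N {n} → n ≤ length (iter N) → occ x n ≡ count x (take n (iter N))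
occ-take x N {zero}  _ = refl
occ-take x N {suc n} n<len = begin
  δ (w (suc n)) x + occ x n
    ≡⟨ cong₂ (λ y k → δ y x + k) (w-nth-iter N n<len) (occ-take x N (<⇒≤ n<len)) ⟩
  δ (nth l n) x + count x (take n l)
    ≡⟨ +-comm _ (count x (take n l)) ⟩
  count x (take n l) + δ (nth l n) x
    ≡⟨ cong (count x (take n l) +_) (+-identityʳ _) ⟨
  count x (take n l) + count x (nth l n ∷ [])
    ≡⟨ count-++ x (take n l) (nth l n ∷ []) ⟨
  count x (take n l ++ nth l n ∷ [])
    ≡⟨ cong (count x) (take-suc-nth l n<len) ⟨
  count x (take (suc n) l)
    ∎
  where
    open ≡-Reasoning
    l = iter N

take-length-++ : ∀ {A : Set} (xs ys : List A) → take (length xs) (xs ++ ys) ≡ xs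
take-length-++ []       ys = refl
take-length-++ (x ∷ xs) ys = cong (x ∷_) (take-length-++ xs ys)

nth-length-++ : ∀ xs y ys → nth (xs ++ y ∷ ys) (length xs) ≡ y
nth-length-++ []       y ys = refl
nth-length-++ (x ∷ xs) y ys = nth-length-++ xs y ys

split-at : ∀ {A : Set} (l : List A) {i} → i < length l →
           ∃[ xs ] ∃[ y ] ∃[ ys ] l ≡ xs ++ y ∷ ys × length xs ≡ i
split-at (x ∷ l) {zero}  _         = [] , x , l , refl , refl
split-at (x ∷ l) {suc i} (s≤s i<n) with split-at l i<n
... | xs , y , ys , eq , len = x ∷ xs , y , ys , cong (x ∷_) eq , cong suc len

w-after-prefix : ∀ N xs y ys → iter N ≡ xs ++ y ∷ ys → w (suc (length xs)) ≡ y
w-after-prefix N xs y ys eq = begin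
  w (suc (length xs))            ≡⟨ w-nth-iter N (subst (λ l → length xs < length l) (sym eq) xs<len) ⟩
  nth (iter N) (length xs)       ≡⟨ cong (λ l → nth l (length xs)) eq ⟩
  nth (xs ++ y ∷ ys) (length xs) ≡⟨ nth-length-++ xs y ys ⟩
  y                              ∎
  where
    open ≡-Reasoning
    xs<len : length xs < length (xs ++ y ∷ ys)
    xs<len = subst (length xs <_) (sym (List.length-++ xs)) (m<m+n (length xs) (s≤s z≤n))

occ-prefix : ∀ x N xs ys → iter N ≡ xs ++ ys → occ x (length xs) ≡ count x xs
occ-prefix x N xs ys eq = begin
  occ x (length xs)                     ≡⟨ occ-take x N (subst (λ l → length xs ≤ length l) (sym eq) (List.length-++-≤ˡ xs)) ⟩
  count x (take (length xs) (iter N))   ≡⟨ cong (λ l → count x (take (length xs) l)) eq ⟩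
  count x (take (length xs) (xs ++ ys)) ≡⟨ cong (count x) (take-length-++ xs ys) ⟩
  count x xs                            ∎
  where open ≡-Reasoning

length-φ* : ∀ xs → length (φ* xs) + count two xs ≡ 2 * length xs
length-φ* []          = refl
length-φ* (one ∷ xs)   = trans (cong (2 +_) (length-φ* xs)) (sym (*-suc 2 (length xs)))
length-φ* (three ∷ xs) = trans (cong (2 +_) (length-φ* xs)) (sym (*-suc 2 (length xs)))
length-φ* (two ∷ xs)   =
  trans (cong suc (+-suc (length (φ* xs)) (count two xs)))
        (trans (cong (2 +_) (length-φ* xs)) (sym (*-suc 2 (length xs))))

count-three-φ* : ∀ xs → count three (φ* xs) ≡ count two xs
count-three-φ* []          = refl
count-three-φ* (one ∷ xs)   = count-three-φ* xs
count-three-φ* (two ∷ xs)   = cong suc (count-three-φ* xs)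
count-three-φ* (three ∷ xs) = count-three-φ* xs

==L-refl : ∀ x → (x ==L x) ≡ true
==L-refl one   = refl
==L-refl two   = refl
==L-refl three = refl

==L-≢ : ∀ {x y} → x ≢ y → (x ==L y) ≡ false
==L-≢ {one}   {one}   x≢y = ⊥-elim (x≢y refl)
==L-≢ {two}   {two}   x≢y = ⊥-elim (x≢y refl)
==L-≢ {three} {three} x≢y = ⊥-elim (x≢y refl)
==L-≢ {one}   {two}   _ = refl
==L-≢ {one}   {three} _ = refl
==L-≢ {two}   {one}   _ = refl
==L-≢ {two}   {three} _ = refl
==L-≢ {three} {one}   _ = refl
==L-≢ {three} {two}   _ = refl

δ≤1 : ∀ y x → δ y x ≤ 1
δ≤1 y x with y ==L x
... | true  = ≤-refl
... | false = z≤n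

occ-hit : ∀ {x} n → w (suc n) ≡ x → occ x (suc n) ≡ suc (occ x n)
occ-hit {x} n eq rewrite eq | ==L-refl x = refl

occ-miss : ∀ {x y} n → w (suc n) ≡ y → y ≢ x → occ x (suc n) ≡ occ x n
occ-miss n eq y≢x rewrite eq | ==L-≢ y≢x = refl

occ-≤ : ∀ x n → occ x n ≤ n
occ-≤ x zero    = z≤n
occ-≤ x (suc n) = +-mono-≤ (δ≤1 (w (suc n)) x) (occ-≤ x n)

occ-mono : ∀ x {p q} → p ≤ q → occ x p ≤ occ x q
occ-mono x {q = zero} z≤n = ≤-refl
occ-mono x {p} {suc q} p≤1+q with m≤n⇒m<n∨m≡n p≤1+q
... | inj₂ refl      = ≤-refl
... | inj₁ (s≤s p≤q) = ≤-trans (occ-mono x p≤q) (m≤n+m (occ x q) (δ (w (suc q)) x))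

occ-< : ∀ {x p q} → p < q → w q ≡ x → occ x p < occ x q
occ-< {x} {p} {suc q} (s≤s p≤q) wq≡x = subst (occ x p <_) (sym (occ-hit q wq≡x)) (s≤s (occ-mono x p≤q))

occurrence-unique : ∀ {x m p q} → IsOccurrence x m p → IsOccurrence x m q → p ≡ q
occurrence-unique {p = p} {q} (wp , op) (wq , oq) with <-cmp p q
... | tri≈ _ p≡q _ = p≡q
... | tri< p<q _ _ = ⊥-elim (<-irrefl (trans op (sym oq)) (occ-< p<q wq))
... | tri> _ _ q<p = ⊥-elim (<-irrefl (trans oq (sym op)) (occ-< q<p wp))

-- Split a prefix of w as xs ++ 2 ∷ ys; its image φ* xs ++ 3 ∷ φ* ys puts the m-th 3 at 1 + |φ* xs| = 2p − m.
three-image-of-two : ∀ {m p c} → IsOccurrence two m p → c + m ≡ 2 * p → IsOccurrence three m c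
three-image-of-two {p = zero} (() , _)
three-image-of-two {m} {suc i} {c} (w≡2 , occ≡m) c+m≡2p
  with split-at (iter (suc i)) (<-trans (n<1+n i) (length-iter (suc i)))
... | xs , y , ys , iter≡ , refl with trans (sym (w-after-prefix (suc i) xs y ys iter≡)) w≡2
... | refl = subst₂ (IsOccurrence three) (sym m≡) (sym c≡) (w≡3 , occ≡)
  where
    image : iter (suc (suc i)) ≡ φ* xs ++ three ∷ φ* ys
    image = trans (cong φ* iter≡) (List.concatMap-++ φ xs (two ∷ ys))
    w≡3 : w (suc (length (φ* xs))) ≡ three
    w≡3 = w-after-prefix (2 + length xs) (φ* xs) three (φ* ys) image
    occ≡ : occ three (suc (length (φ* xs))) ≡ suc (count two xs)
    occ≡ = trans (occ-hit (length (φ* xs)) w≡3)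
                 (cong suc (trans (occ-prefix three (2 + length xs) (φ* xs) (three ∷ φ* ys) image)
                                  (count-three-φ* xs)))
    m≡ : m ≡ suc (count two xs)
    m≡ = trans (sym occ≡m) (trans (occ-hit (length xs) w≡2)
                                  (cong suc (occ-prefix two (suc (length xs)) xs (two ∷ ys) iter≡)))
    c≡ : c ≡ suc (length (φ* xs))
    c≡ = +-cancelʳ-≡ m c _ (begin
      c + m                                     ≡⟨ c+m≡2p ⟩
      2 * suc (length xs)                       ≡⟨ *-suc 2 (length xs) ⟩
      2 + 2 * length xs                         ≡⟨ cong (2 +_) (length-φ* xs) ⟨
      2 + (length (φ* xs) + count two xs)       ≡⟨ cong suc (+-suc (length (φ* xs)) (count two xs)) ⟨
      suc (length (φ* xs)) + suc (count two xs) ≡⟨ cong (suc (length (φ* xs)) +_) m≡ ⟨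
      suc (length (φ* xs)) + m                  ∎)
      where open ≡-Reasoning

elem⇒∈ : ∀ {n} l → elem n l ≡ true → n ∈ l
elem⇒∈ {n} (x ∷ xs) e with n ≡ᵇ x in n≡ᵇx
... | true  = here (≡ᵇ⇒≡ n x (subst T (sym n≡ᵇx) tt))
... | false = there (elem⇒∈ xs e)

∉⇒elem : ∀ {n} l → n ∉ l → elem n l ≡ false
∉⇒elem {n} l n∉l with elem n l in e
... | true  = ⊥-elim (n∉l (elem⇒∈ l e))
... | false = refl

∈⇒elem : ∀ {n l} → n ∈ l → elem n l ≡ true
∈⇒elem {n} {x ∷ xs} n∈l with n ≡ᵇ x in n≡ᵇx | n∈l
... | true  | _          = refl
... | false | here n≡x   = ⊥-elim (subst T n≡ᵇx (≡⇒≡ᵇ n x n≡x))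
... | false | there n∈xs = ∈⇒elem n∈xs

mexFrom-least : ∀ {l t} f k → k ≤ t → t ≤ f + k → (∀ {p} → p < t → p ∈ l) → t ∉ l → mexFrom f k l ≡ t
mexFrom-least zero    k k≤t t≤k _ _ = ≤-antisym k≤t t≤k
mexFrom-least {l} {t} (suc f) k k≤t t≤f+k below t∉l with m≤n⇒m<n∨m≡n k≤t
... | inj₁ k<t  rewrite ∈⇒elem (below k<t) =
  mexFrom-least f (suc k) k<t (subst (t ≤_) (sym (+-suc f k)) t≤f+k) below t∉l
... | inj₂ refl rewrite ∉⇒elem l t∉l = refl

mex-least : ∀ {l t} → t ≤ suc (length l) → (∀ {p} → p < t → p ∈ l) → t ∉ l → mex l ≡ t
mex-least {l} {t} t≤ = mexFrom-least (suc (length l)) 0 z≤n (subst (t ≤_) (sym (+-identityʳ _)) t≤)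

history : ℕ → List ℕ
history m = proj₂ (state m)

C-next : ℕ → ℕ → ℕ → ℕ
C-next a c a′ = if does (a′ ≟ a + 2) then c + 3 else c + 5

balance-shift : ∀ {m a c} d → c + m ≡ 2 * suc a → c + (1 + 2 * d) + suc m ≡ 2 * suc (a + suc d)
balance-shift {m} {a} {c} d c+m≡ = begin
  c + (1 + 2 * d) + suc m   ≡⟨ regroup c d m ⟩
  (c + m) + 2 * suc d       ≡⟨ cong (_+ 2 * suc d) c+m≡ ⟩
  2 * suc a + 2 * suc d     ≡⟨ distrib a d ⟩
  2 * suc (a + suc d)       ∎
  where
    open ≡-Reasoning
    regroup : ∀ c d m → c + (1 + 2 * d) + suc m ≡ (c + m) + 2 * suc d
    regroup = solve-∀
    distrib : ∀ a d → 2 * suc a + 2 * suc d ≡ 2 * suc (a + suc d)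
    distrib = solve-∀

C-next-by-2 : ∀ a c → C-next a c (a + 2) ≡ c + 3
C-next-by-2 a c = cong (λ b → if b then c + 3 else c + 5) (dec-true (a + 2 ≟ a + 2) refl)

C-next-by-3 : ∀ a c → C-next a c (a + 3) ≡ c + 5
C-next-by-3 a c = cong (λ b → if b then c + 3 else c + 5) (dec-false (a + 3 ≟ a + 2) 3≢2)
  where 3≢2 : a + 3 ≢ a + 2
        3≢2 eq with +-cancelˡ-≡ a 3 2 eq
        ... | ()

C-next-balance : ∀ {m a c t} → c + m ≡ 2 * suc a → a + 2 ≤ t → t ≤ a + 3 → C-next a c t + suc m ≡ 2 * suc t
C-next-balance {a = a} {c} {t} c+m≡ a+2≤t t≤a+3 with m≤n⇒m<n∨m≡n a+2≤t
... | inj₂ refl rewrite C-next-by-2 a c = balance-shift 1 c+m≡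
... | inj₁ a+2<t with ≤-antisym t≤a+3 (subst (_≤ t) (sym (+-suc a 2)) a+2<t)
...   | refl rewrite C-next-by-3 a c = balance-shift 2 c+m≡

balance-lower : ∀ {m a c} → c + m ≡ 2 * suc a → m ≤ a → 2 + a ≤ c
balance-lower {m} {a} {c} c+m≡ m≤a = +-cancelʳ-≤ m (2 + a) c (begin
  2 + a + m   ≤⟨ +-monoʳ-≤ (2 + a) m≤a ⟩
  2 + a + a   ≡⟨ double a ⟩
  2 * suc a   ≡⟨ c+m≡ ⟨
  c + m       ∎)
  where
    open ≤-Reasoning
    double : ∀ a → 2 + a + a ≡ 2 * suc a
    double = solve-∀

record Invariant (m a c : ℕ) (h : List ℕ) : Set where
  field
    A-occurrence      : IsOccurrence one m a
    B-occurrence      : IsOccurrence two m (suc a)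
    C-balance         : c + m ≡ 2 * suc a
    mex-fuel          : a + 2 ≤ length h   -- the search in mex must be allowed to reach A_{m+1} ≤ a + 3
    initial-⊆-history : ∀ {p} → p ≤ suc a → p ∈ h
    history-ones-≤    : ∀ {p} → p ∈ h → w p ≡ one → p ≤ a
    threes-⊆-history  : ∀ {p} → w p ≡ three → occ three p ≤ m → p ∈ h

  C-occurrence : IsOccurrence three m c
  C-occurrence = three-image-of-two B-occurrence C-balance

invariant-one : Invariant 1 1 3 (history 1)
invariant-one = record
  { A-occurrence      = refl , refl
  ; B-occurrence      = refl , refl
  ; C-balance         = refl
  ; mex-fuel          = s≤s (s≤s (s≤s z≤n))
  ; initial-⊆-history = initial
  ; history-ones-≤    = All.lookup ones
  ; threes-⊆-history  = threes
  }
  where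
    initial : ∀ {p} → p ≤ 2 → p ∈ history 1
    initial {0} _ = there (there (there (here refl)))
    initial {1} _ = here refl
    initial {2} _ = there (here refl)
    initial {suc (suc (suc _))} (s≤s (s≤s ()))
    ones : All (λ p → w p ≡ one → p ≤ 1) (history 1)
    ones = (λ _ → ≤-refl) ∷ (λ ()) ∷ (λ ()) ∷ (λ _ → z≤n) ∷ (λ _ → z≤n) ∷ (λ _ → z≤n) ∷ []
    threes : ∀ {p} → w p ≡ three → occ three p ≤ 1 → p ∈ history 1
    threes {zero}  ()
    threes {suc q} w≡3 occ≤1 = subst (_∈ history 1) (occurrence-unique (refl , refl) (w≡3 , occ≡1)) (there (there (here refl)))
      where occ≡1 = ≤-antisym occ≤1 (subst (1 ≤_) (sym (occ-hit q w≡3)) (s≤s z≤n))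

NextInvariant : ℕ → ℕ → ℕ → List ℕ → ℕ → Set
NextInvariant m a c h t = Invariant (suc m) t (C-next a c t) (t ∷ suc t ∷ C-next a c t ∷ h)

module _ {m a c h} (I : Invariant m a c h) where
  open Invariant I

  step-at : ∀ t → a + 2 ≤ t → t ≤ a + 3 → w t ≡ one → occ one t ≡ suc m → occ two t ≡ m →
            (∀ {p} → p < t → p ∈ h) → NextInvariant m a c h (mex h)
  step-at t a+2≤t t≤a+3 w≡1 occ1≡ occ2≡ below = subst (NextInvariant m a c h) (sym mex≡t) (record
    { A-occurrence      = w≡1 , occ1≡
    ; B-occurrence      = B′
    ; C-balance         = balance
    ; mex-fuel          = ≤-trans (+-monoˡ-≤ 2 t≤a+3) (≤-trans (≤-reflexive (shift a)) (+-monoʳ-≤ 3 mex-fuel))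
    ; initial-⊆-history = initial
    ; history-ones-≤    = ones
    ; threes-⊆-history  = threes
    })
    where
      a<t : a < t
      a<t = ≤-trans (m<m+n a (s≤s z≤n)) a+2≤t
      mex≡t : mex h ≡ t
      mex≡t = mex-least (≤-trans t≤a+3 (≤-trans (≤-reflexive (+-suc a 2)) (s≤s mex-fuel))) below
                        (λ t∈h → <⇒≱ a<t (history-ones-≤ t∈h w≡1))
      c′ = C-next a c t
      balance : c′ + suc m ≡ 2 * suc t
      balance = C-next-balance C-balance a+2≤t t≤a+3
      w[1+t]≡2 : w (suc t) ≡ two
      w[1+t]≡2 = one-then-two t (≤-<-trans z≤n a<t) w≡1
      B′ : IsOccurrence two (suc m) (suc t)
      B′ = w[1+t]≡2 , trans (occ-hit t w[1+t]≡2) (cong suc occ2≡)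
      C′ : IsOccurrence three (suc m) c′
      C′ = three-image-of-two B′ balance
      shift : ∀ a → a + 3 + 2 ≡ 3 + (a + 2)
      shift = solve-∀
      initial : ∀ {p} → p ≤ suc t → p ∈ t ∷ suc t ∷ c′ ∷ h
      initial p≤1+t with m≤n⇒m<n∨m≡n p≤1+t
      ... | inj₂ refl = there (here refl)
      ... | inj₁ (s≤s p≤t) with m≤n⇒m<n∨m≡n p≤t
      ...   | inj₂ refl = here refl
      ...   | inj₁ p<t  = there (there (there (below p<t)))
      ones : ∀ {p} → p ∈ t ∷ suc t ∷ c′ ∷ h → w p ≡ one → p ≤ t
      ones (here refl)                      _    = ≤-refl
      ones (there (here refl))              w≡1′ = contradiction (trans (sym w[1+t]≡2) w≡1′) λ ()
      ones (there (there (here refl)))      w≡1′ = contradiction (trans (sym (proj₁ C′)) w≡1′) λ ()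
      ones (there (there (there p∈h)))      w≡1′ = ≤-trans (history-ones-≤ p∈h w≡1′) (<⇒≤ a<t)
      threes : ∀ {p} → w p ≡ three → occ three p ≤ suc m → p ∈ t ∷ suc t ∷ c′ ∷ h
      threes w≡3 occ≤ with m≤n⇒m<n∨m≡n occ≤
      ... | inj₁ (s≤s occ≤m) = there (there (there (threes-⊆-history w≡3 occ≤m)))
      ... | inj₂ occ≡        = there (there (here (occurrence-unique (w≡3 , occ≡) C′)))

  w[1+a]≡2 : w (suc a) ≡ two
  w[1+a]≡2 = proj₁ B-occurrence

  step-by-2 : w (2 + a) ≡ one → NextInvariant m a c h (mex h)
  step-by-2 w≡1 = step-at (2 + a) (≤-reflexive (+-comm a 2)) (≤-trans (n≤1+n (2 + a)) (≤-reflexive (+-comm 3 a)))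
    w≡1 occ1≡ occ2≡ (λ p<2+a → initial-⊆-history (≤-pred p<2+a))
    where
      occ1≡ : occ one (2 + a) ≡ suc m
      occ1≡ = trans (occ-hit (suc a) w≡1) (cong suc (trans (occ-miss a w[1+a]≡2 λ ()) (proj₂ A-occurrence)))
      occ2≡ : occ two (2 + a) ≡ m
      occ2≡ = trans (occ-miss (suc a) w≡1 λ ()) (proj₂ B-occurrence)

  step-by-3 : w (2 + a) ≡ three → NextInvariant m a c h (mex h)
  step-by-3 w≡3 = step-at (3 + a) (≤-trans (≤-reflexive (+-comm a 2)) (n≤1+n (2 + a))) (≤-reflexive (+-comm 3 a))
    w[3+a]≡1 occ1≡ occ2≡ below
    where
      w[3+a]≡1 : w (3 + a) ≡ one
      w[3+a]≡1 = three-then-one (2 + a) w≡3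
      occ1≡ : occ one (3 + a) ≡ suc m
      occ1≡ = trans (occ-hit (2 + a) w[3+a]≡1) (cong suc (
                trans (occ-miss (suc a) w≡3 λ ()) (trans (occ-miss a w[1+a]≡2 λ ()) (proj₂ A-occurrence))))
      occ2≡ : occ two (3 + a) ≡ m
      occ2≡ = trans (occ-miss (2 + a) w[3+a]≡1 λ ()) (trans (occ-miss (suc a) w≡3 λ ()) (proj₂ B-occurrence))
      2+a≤c : 2 + a ≤ c
      2+a≤c = balance-lower C-balance (subst (_≤ a) (proj₂ A-occurrence) (occ-≤ one a))
      below : ∀ {p} → p < 3 + a → p ∈ h
      below p<3+a with m≤n⇒m<n∨m≡n (≤-pred p<3+a)
      ... | inj₁ p<2+a = initial-⊆-history (≤-pred p<2+a)
      ... | inj₂ refl  = threes-⊆-history w≡3 (subst (occ three (2 + a) ≤_) (proj₂ C-occurrence) (occ-mono three 2+a≤c))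

  invariant-step : NextInvariant m a c h (mex h)
  invariant-step with two-then-one-or-three (suc a) w[1+a]≡2
  ... | inj₁ w≡1 = step-by-2 w≡1
  ... | inj₂ w≡3 = step-by-3 w≡3

-- invariant-step follows the recursion of state, so the types below agree by computation.
reached : ∀ k → Invariant (suc k) (A (suc k)) (C (suc k)) (history (suc k))
reached zero    = invariant-one
reached (suc k) = invariant-step (reached k)

B≡suc-A : ∀ k → B (suc k) ≡ suc (A (suc k))
B≡suc-A zero    = refl
B≡suc-A (suc k) = refl

lemma6p22 : (m : ℕ) → m ≥ 1 →
    IsOccurrence one m (A m) × IsOccurrence two m (B m) × IsOccurrence three m (C m)
lemma6p22 (suc k) _ = A-occurrence , subst (IsOccurrence two (suc k)) (sym (B≡suc-A k)) B-occurrence , C-occurrence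
  where open Invariant (reached k)
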